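{- Let $A$ and $k$ be positive integers and consider the equation \[\sigma_2(n)-n^2=An+(k^2+1)\] in positive integers $n$. (i) If $A\neq 2$ or $k$ is odd, then the equation has only finitely many solutions. (ii) If $A=2$ and $k$ is even, then every solution $n$ with $n\ge (|A|+k^2+1)^3$ is of the form $n=p(p+k)$, where both $p$ and $p+k$ are primes.
   Context: $\sigma_2(n)=\sum_{d\mid n}d^2$. -}

module Defs where

open import Data.Nat using (ℕ; suc; _+_; _*_; _^_)
open import Data.Nat.Divisibility using (_∣_; _∣?_)
open import Data.List using (List; map; filter; upTo)
open import Data.Nat.ListAction using (sum)
open import Relation.Binary.PropositionalEquality using (_≡_)

-- positive divisors of n: those d ∈ {1,…,n} with d ∣ n  (empty for n = 0)
divisors : ℕ → List ℕ
divisors n = filter (_∣? n) (map suc (upTo n))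

σ₂ : ℕ → ℕ
σ₂ n = sum (map (λ d → d ^ 2) (divisors n))

-- n is a positive-integer solution of σ₂(n) − n² = A n + (k² + 1)
-- (stated additively; σ₂(n) ≥ n² for n ≥ 1, so no truncation issue)
IsSolution : ℕ → ℕ → ℕ → Set
IsSolution A k n = σ₂ n ≡ n ^ 2 + A * n + (k ^ 2 + 1)

module Submission where

-- The partial sums σ₂≤ n N of d² over the divisors d ≤ N of n let us evaluate σ₂ by
-- walking from one divisor to the next: σ₂ of a prime, of a prime square and of a
-- product of two distinct primes is computed exactly, and any proper divisor m > 1
-- gives the lower bound σ₂(n) ≥ 1 + m² + n².  Splitting off the least prime factor,
-- every n ≥ 2 is a prime, a product pq of primes p ≤ q, or p·m with p² ≤ m.  For a
-- solution, n = p and n = p² have too small σ₂, n = p·m with p² ≤ m forces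
-- n < (A + k² + 1)³, and n = pq with p < q turns the equation into the quadratic
-- relation p² + q² = A·pq + k² (solution-structure).  The relation is then solved:
-- A = 1 gives pq ≤ k², A ≥ 3 gives p = k and q = Ak (as p² ≡ k² mod q), and A = 2
-- gives q = p + k, which for odd k forces p = 2.  Part (i) follows with an explicit
-- bound, part (ii) from q = p + k.

open import Defs
open import Data.Nat using (ℕ; _+_; _*_; _^_; _≤_; _≥_; NonZero)
open import Data.Nat.Primality using (Prime)
open import Data.Nat.Divisibility using (_∣_)
open import Data.Product using (_×_; Σ; ∃; _,_)
open import Data.Sum using (_⊎_)
open import Relation.Nullary using (¬_)
open import Relation.Binary.PropositionalEquality using (_≡_)

open import Data.Nat
open import Data.Nat.Properties
open import Data.Nat.Divisibility
open import Data.Nat.Primality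
open import Data.Nat.Tactic.RingSolver using (solve-∀; solve)
open import Data.List using (List; map; filter; upTo; _++_; [_]; []; _∷_)
open import Data.List.Properties using (upTo-∷ʳ; map-++; filter-++; filter-accept; filter-reject)
open import Data.Nat.ListAction using (sum)
open import Data.Nat.ListAction.Properties using (sum-++)
open import Data.Product using (∃₂)
open import Data.Sum using (inj₁; inj₂)
open import Function using (_∘_)
open import Relation.Binary.Definitions using (tri<; tri≈; tri>)
open import Relation.Nullary using (yes; no; contradiction)
open import Relation.Binary.PropositionalEquality
  using (_≢_; ≢-sym; refl; sym; trans; cong; cong₂; subst; module ≡-Reasoning)

square : ∀ x → x ^ 2 ≡ x * x
square x = cong (x *_) (*-identityʳ x)

divisorSquareSum : ℕ → List ℕ → ℕ
divisorSquareSum n ds = sum (map (λ d → d ^ 2) (filter (_∣? n) ds))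

divisorSquareSum-++ : ∀ n xs ys →
  divisorSquareSum n (xs ++ ys) ≡ divisorSquareSum n xs + divisorSquareSum n ys
divisorSquareSum-++ n xs ys = begin
  sum (map _ (filter (_∣? n) (xs ++ ys)))
    ≡⟨ cong (sum ∘ map _) (filter-++ (_∣? n) xs ys) ⟩
  sum (map _ (filter (_∣? n) xs ++ filter (_∣? n) ys))
    ≡⟨ cong sum (map-++ _ (filter (_∣? n) xs) (filter (_∣? n) ys)) ⟩
  sum (map _ (filter (_∣? n) xs) ++ map _ (filter (_∣? n) ys))
    ≡⟨ sum-++ (map _ (filter (_∣? n) xs)) _ ⟩
  divisorSquareSum n xs + divisorSquareSum n ys ∎
  where open ≡-Reasoning

-- Partial divisor sum: σ₂≤ n N = Σ { d² | d ∣ n, 1 ≤ d ≤ N }, so σ₂ n = σ₂≤ n n.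
σ₂≤ : ℕ → ℕ → ℕ
σ₂≤ n N = divisorSquareSum n (map suc (upTo N))

σ₂≤-suc : ∀ n N → σ₂≤ n (suc N) ≡ σ₂≤ n N + divisorSquareSum n [ suc N ]
σ₂≤-suc n N = begin
  σ₂≤ n (suc N)
    ≡⟨ cong (divisorSquareSum n ∘ map suc) (sym (upTo-∷ʳ N)) ⟩
  divisorSquareSum n (map suc (upTo N ++ [ N ]))
    ≡⟨ cong (divisorSquareSum n) (map-++ suc (upTo N) [ N ]) ⟩
  divisorSquareSum n (map suc (upTo N) ++ [ suc N ])
    ≡⟨ divisorSquareSum-++ n (map suc (upTo N)) [ suc N ] ⟩
  σ₂≤ n N + divisorSquareSum n [ suc N ] ∎
  where open ≡-Reasoning

σ₂≤-step-∣ : ∀ {n} N → suc N ∣ n → σ₂≤ n (suc N) ≡ σ₂≤ n N + suc N * suc N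
σ₂≤-step-∣ {n} N 1+N∣n rewrite σ₂≤-suc n N | filter-accept (_∣? n) {xs = []} 1+N∣n =
  cong (σ₂≤ n N +_) (trans (+-identityʳ _) (square (suc N)))

σ₂≤-step-∤ : ∀ {n} N → ¬ suc N ∣ n → σ₂≤ n (suc N) ≡ σ₂≤ n N
σ₂≤-step-∤ {n} N 1+N∤n rewrite σ₂≤-suc n N | filter-reject (_∣? n) {xs = []} 1+N∤n =
  +-identityʳ _

σ₂≤-one : ∀ n → σ₂≤ n 1 ≡ 1
σ₂≤-one n = σ₂≤-step-∣ 0 (1∣ n)

σ₂≤-mono : ∀ {n a} b → a ≤ b → σ₂≤ n a ≤ σ₂≤ n b
σ₂≤-mono {n} {a} b a≤b with m≤n⇒m<n∨m≡n a≤b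
... | inj₂ refl = ≤-refl
σ₂≤-mono {n} (suc b) _ | inj₁ a<1+b with suc b ∣? n
... | yes 1+b∣n = ≤-trans (σ₂≤-mono b (s≤s⁻¹ a<1+b))
                    (≤-trans (m≤m+n _ _) (≤-reflexive (sym (σ₂≤-step-∣ b 1+b∣n))))
... | no 1+b∤n  = ≤-trans (σ₂≤-mono b (s≤s⁻¹ a<1+b)) (≤-reflexive (sym (σ₂≤-step-∤ b 1+b∤n)))

σ₂≤-divisor : ∀ {n a b} → a < b → b ∣ n → σ₂≤ n a + b * b ≤ σ₂≤ n b
σ₂≤-divisor {n} {a} {suc b} a<1+b 1+b∣n = begin
  σ₂≤ n a + suc b * suc b ≤⟨ +-monoˡ-≤ _ (σ₂≤-mono b (s≤s⁻¹ a<1+b)) ⟩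
  σ₂≤ n b + suc b * suc b ≡⟨ sym (σ₂≤-step-∣ b 1+b∣n) ⟩
  σ₂≤ n (suc b)           ∎
  where open ≤-Reasoning

Outside : ℕ → ℕ → ℕ → Set
Outside a b x = x ≤ a ⊎ b ≤ x

NoDivisorBetween : ℕ → ℕ → ℕ → Set
NoDivisorBetween n a b = ∀ {d} → d ∣ n → Outside a b d

σ₂≤-flat : ∀ {n a} b → a ≤ b → NoDivisorBetween n a (suc b) → σ₂≤ n b ≡ σ₂≤ n a
σ₂≤-flat {n} {a} b a≤b gap with m≤n⇒m<n∨m≡n a≤b
... | inj₂ refl = refl
σ₂≤-flat (suc b) _ gap | inj₁ a<1+b =
  trans (σ₂≤-step-∤ b b∤n) (σ₂≤-flat b (s≤s⁻¹ a<1+b) gap′)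
  where
  b∤n : ¬ suc b ∣ _
  b∤n b∣n with gap b∣n
  ... | inj₁ 1+b≤a   = <⇒≱ a<1+b 1+b≤a
  ... | inj₂ 2+b≤1+b = 1+n≰n 2+b≤1+b
  gap′ : NoDivisorBetween _ _ (suc b)
  gap′ d∣n with gap d∣n
  ... | inj₁ d≤a   = inj₁ d≤a
  ... | inj₂ 2+b≤d = inj₂ (<⇒≤ 2+b≤d)

σ₂≤-next-divisor : ∀ {n a b} → a < b → b ∣ n → NoDivisorBetween n a b →
  σ₂≤ n b ≡ σ₂≤ n a + b * b
σ₂≤-next-divisor {n} {a} {suc b} a<1+b b∣n gap =
  trans (σ₂≤-step-∣ b b∣n) (cong (_+ suc b * suc b) (σ₂≤-flat b (s≤s⁻¹ a<1+b) gap))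

prime⇒1<p : ∀ {p} → Prime p → 1 < p
prime⇒1<p {p} p-prime = nonTrivial⇒n>1 p {{prime⇒nonTrivial p-prime}}

semiprime-divisor : ∀ {p q d} → Prime p → Prime q → d ∣ p * q →
  d ≡ 1 ⊎ d ≡ p ⊎ d ≡ q ⊎ d ≡ p * q
semiprime-divisor {p} {q} {d} p-prime q-prime (divides e pq≡ed)
  with euclidsLemma e d p-prime (subst (p ∣_) pq≡ed (m∣m*n q))
... | inj₁ (divides e′ e≡e′p) with prime⇒irreducible q-prime d∣q
  where
  instance _ = prime⇒nonZero p-prime
  d∣q : d ∣ q
  d∣q = divides e′ (*-cancelˡ-≡ q (e′ * d) p (begin
    p * q        ≡⟨ pq≡ed ⟩
    e * d        ≡⟨ cong (_* d) e≡e′p ⟩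
    e′ * p * d   ≡⟨ cong (_* d) (*-comm e′ p) ⟩
    p * e′ * d   ≡⟨ *-assoc p e′ d ⟩
    p * (e′ * d) ∎))
    where open ≡-Reasoning
...   | inj₁ d≡1 = inj₁ d≡1
...   | inj₂ d≡q = inj₂ (inj₂ (inj₁ d≡q))
semiprime-divisor {p} {q} {d} p-prime q-prime (divides e pq≡ed)
  | inj₂ (divides d′ d≡d′p) with prime⇒irreducible q-prime d′∣q
  where
  instance _ = prime⇒nonZero p-prime
  d′∣q : d′ ∣ q
  d′∣q = *-cancelˡ-∣ p (subst (_∣ p * q) (trans d≡d′p (*-comm d′ p)) (divides e pq≡ed))
...   | inj₁ refl = inj₂ (inj₁ (trans d≡d′p (+-identityʳ p)))
...   | inj₂ refl = inj₂ (inj₂ (inj₂ (trans d≡d′p (*-comm q p))))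

semiprime-gap : ∀ {p q a b} → Prime p → Prime q →
  Outside a b 1 → Outside a b p → Outside a b q → Outside a b (p * q) →
  NoDivisorBetween (p * q) a b
semiprime-gap p-prime q-prime out₁ outp outq outn d∣pq
  with semiprime-divisor p-prime q-prime d∣pq
... | inj₁ refl               = out₁
... | inj₂ (inj₁ refl)        = outp
... | inj₂ (inj₂ (inj₁ refl)) = outq
... | inj₂ (inj₂ (inj₂ refl)) = outn

σ₂-prime : ∀ {p} → Prime p → σ₂ p ≡ 1 + p * p
σ₂-prime {p} p-prime = begin
  σ₂≤ p p           ≡⟨ σ₂≤-next-divisor (prime⇒1<p p-prime) ∣-refl gap ⟩
  σ₂≤ p 1 + p * p   ≡⟨ cong (_+ p * p) (σ₂≤-one p) ⟩
  1 + p * p         ∎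
  where
  open ≡-Reasoning
  gap : NoDivisorBetween p 1 p
  gap d∣p with prime⇒irreducible p-prime d∣p
  ... | inj₁ refl = inj₁ ≤-refl
  ... | inj₂ refl = inj₂ ≤-refl

σ₂-prime-square : ∀ {p} → Prime p → σ₂ (p * p) ≡ 1 + p * p + (p * p) * (p * p)
σ₂-prime-square {p} p-prime = begin
  σ₂≤ n n                 ≡⟨ σ₂≤-next-divisor p<n ∣-refl no-divisor-in-⟨p,n⟩ ⟩
  σ₂≤ n p + n * n         ≡⟨ cong (_+ n * n) (σ₂≤-next-divisor 1<p (m∣m*n p) no-divisor-in-⟨1,p⟩) ⟩
  σ₂≤ n 1 + p * p + n * n ≡⟨ cong (λ s → s + p * p + n * n) (σ₂≤-one n) ⟩
  1 + p * p + n * n       ∎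
  where
  open ≡-Reasoning
  n = p * p
  1<p : 1 < p
  1<p = prime⇒1<p p-prime
  p<n : p < n
  p<n = m<m*n p p {{prime⇒nonZero p-prime}} 1<p
  no-divisor-in-⟨1,p⟩ : NoDivisorBetween n 1 p
  no-divisor-in-⟨1,p⟩ = semiprime-gap p-prime p-prime
    (inj₁ ≤-refl) (inj₂ ≤-refl) (inj₂ ≤-refl) (inj₂ (<⇒≤ p<n))
  no-divisor-in-⟨p,n⟩ : NoDivisorBetween n p n
  no-divisor-in-⟨p,n⟩ = semiprime-gap p-prime p-prime
    (inj₁ (<⇒≤ 1<p)) (inj₁ ≤-refl) (inj₁ ≤-refl) (inj₂ ≤-refl)

σ₂-semiprime : ∀ {p q} → Prime p → Prime q → p < q →
  σ₂ (p * q) ≡ 1 + p * p + q * q + (p * q) * (p * q)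
σ₂-semiprime {p} {q} p-prime q-prime p<q = begin
  σ₂≤ n n                         ≡⟨ σ₂≤-next-divisor q<n ∣-refl no-divisor-in-⟨q,n⟩ ⟩
  σ₂≤ n q + n * n                 ≡⟨ cong (_+ n * n) (σ₂≤-next-divisor p<q (n∣m*n p) no-divisor-in-⟨p,q⟩) ⟩
  σ₂≤ n p + q * q + n * n         ≡⟨ cong (λ s → s + q * q + n * n)
                                       (σ₂≤-next-divisor 1<p (m∣m*n q) no-divisor-in-⟨1,p⟩) ⟩
  σ₂≤ n 1 + p * p + q * q + n * n ≡⟨ cong (λ s → s + p * p + q * q + n * n) (σ₂≤-one n) ⟩
  1 + p * p + q * q + n * n       ∎
  where
  open ≡-Reasoning
  n = p * q
  1<p : 1 < p
  1<p = prime⇒1<p p-prime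
  q<n : q < n
  q<n = subst (q <_) (*-comm q p) (m<m*n q p {{prime⇒nonZero q-prime}} 1<p)
  no-divisor-in-⟨1,p⟩ : NoDivisorBetween n 1 p
  no-divisor-in-⟨1,p⟩ = semiprime-gap p-prime q-prime
    (inj₁ ≤-refl) (inj₂ ≤-refl) (inj₂ (<⇒≤ p<q)) (inj₂ (≤-trans (<⇒≤ p<q) (<⇒≤ q<n)))
  no-divisor-in-⟨p,q⟩ : NoDivisorBetween n p q
  no-divisor-in-⟨p,q⟩ = semiprime-gap p-prime q-prime
    (inj₁ (<⇒≤ 1<p)) (inj₁ ≤-refl) (inj₂ ≤-refl) (inj₂ (<⇒≤ q<n))
  no-divisor-in-⟨q,n⟩ : NoDivisorBetween n q n
  no-divisor-in-⟨q,n⟩ = semiprime-gap p-prime q-prime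
    (inj₁ (≤-trans (<⇒≤ 1<p) (<⇒≤ p<q))) (inj₁ (<⇒≤ p<q)) (inj₁ ≤-refl) (inj₂ ≤-refl)

σ₂-lower-bound : ∀ {n m} → 1 < m → m < n → m ∣ n → 1 + m * m + n * n ≤ σ₂ n
σ₂-lower-bound {n} {m} 1<m m<n m∣n = begin
  1 + m * m + n * n       ≡⟨ cong (λ s → s + m * m + n * n) (sym (σ₂≤-one n)) ⟩
  σ₂≤ n 1 + m * m + n * n ≤⟨ +-monoˡ-≤ (n * n) (σ₂≤-divisor 1<m m∣n) ⟩
  σ₂≤ n m + n * n         ≤⟨ σ₂≤-divisor m<n ∣-refl ⟩
  σ₂≤ n n                 ∎
  where open ≤-Reasoning

-- Searching upward from m while staying m-rough, the first divisor of n found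
-- is its least prime factor.
least-prime-factor-from : ∀ {n} k m → m + k ≡ n → 1 < m → m Rough n →
  ∃ λ p → Prime p × p ∣ n × p Rough n
least-prime-factor-from {n} k m m+k≡n 1<m rough with m ∣? n
... | yes m∣n = m , rough∧∣⇒prime {{n>1⇒nonTrivial 1<m}} rough m∣n , m∣n , rough
least-prime-factor-from zero m m+0≡n _ _ | no m∤n =
  contradiction (subst (m ∣_) (trans (sym (+-identityʳ m)) m+0≡n) ∣-refl) m∤n
least-prime-factor-from (suc k) m m+1+k≡n 1<m rough | no m∤n =
  least-prime-factor-from k (suc m) (trans (sym (+-suc m k)) m+1+k≡n) (m<n⇒m<1+n 1<m)
    (∤⇒rough-suc m∤n rough)

least-prime-factor : ∀ {n} → 1 < n → ∃ λ p → Prime p × p ∣ n × p Rough n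
least-prime-factor {n} 1<n = least-prime-factor-from (n ∸ 2) 2 (m+[n∸m]≡n 1<n) ≤-refl 2-rough

-- Every n ≥ 2 is a prime, a product of two primes p ≤ q, or p·m with p ≥ 2 and p² ≤ m
-- (split off the least prime factor p; the cofactor m is p-rough, hence prime unless p² ≤ m).
data Shape (n : ℕ) : Set where
  prime-shape     : Prime n → Shape n
  semiprime-shape : ∀ {p q} → Prime p → Prime q → p ≤ q → n ≡ p * q → Shape n
  cube-shape      : ∀ {p m} → 1 < p → p * p ≤ m → n ≡ p * m → Shape n

shape : ∀ {n} → 1 < n → Shape n
shape {n} 1<n with least-prime-factor 1<n
... | _ , _ , divides zero n≡0 , _ =
  contradiction n≡0 (≢-nonZero⁻¹ n {{>-nonZero (<-trans z<s 1<n)}})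
... | p , p-prime , divides 1 n≡1*p , _ =
  prime-shape (subst Prime (sym (trans n≡1*p (+-identityʳ p))) p-prime)
... | p , p-prime , divides m@(suc (suc _)) n≡mp , rough with p * p ≤? m
...   | yes p²≤m = cube-shape (prime⇒1<p p-prime) p²≤m n≡pm
  where
  n≡pm : n ≡ p * m
  n≡pm = trans n≡mp (*-comm m p)
...   | no p²≰m  = semiprime-shape p-prime m-prime (rough⇒≤ m-rough) n≡pm
  where
  n≡pm : n ≡ p * m
  n≡pm = trans n≡mp (*-comm m p)
  m-rough : p Rough m
  m-rough = rough∧∣⇒rough rough (divides p n≡pm)
  m-prime : Prime m
  m-prime = rough∧square>⇒prime m-rough (≰⇒> p²≰m)

solution-equation : ∀ {A k n} → IsSolution A k n → σ₂ n ≡ n * n + A * n + (k * k + 1)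
solution-equation {A} {k} {n} sol = trans sol (cong₂ (λ a b → a + A * n + (b + 1)) (square n) (square k))

-- σ₂(1) = 1 is too small, so every solution exceeds 1.
solution>1 : ∀ {A k n} → 1 ≤ n → IsSolution A k n → 1 < n
solution>1 {A} {k} {suc zero} _ sol =
  contradiction sol (<⇒≢ (s≤s (≤-trans (m≤n+m 1 (k ^ 2)) (m≤n+m _ (A * 1)))))
solution>1 {n = suc (suc _)} _ _ = s≤s (s≤s z≤n)

-- If the divisors of n other than n itself contribute 1 + x ≤ 1 + A·n, the equation fails,
-- because the right-hand side exceeds n² + A·n + 1.
divisor-sum-too-small : ∀ A k n x → 1 ≤ k → x ≤ A * n →
  1 + x + n * n ≢ n * n + A * n + (k * k + 1)
divisor-sum-too-small A k n x 1≤k x≤An = <⇒≢ (begin-strict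
  1 + x + n * n           ≡⟨ solve (x ∷ n ∷ []) ⟩
  n * n + x + 1           ≤⟨ +-monoˡ-≤ 1 (+-monoʳ-≤ (n * n) x≤An) ⟩
  n * n + A * n + 1       <⟨ +-monoʳ-< (n * n + A * n) (+-monoˡ-< 1 (*-mono-≤ 1≤k 1≤k)) ⟩
  n * n + A * n + (k * k + 1) ∎)
  where open ≤-Reasoning

semiprime-relation : ∀ A k p q n → 1 + p * p + q * q + n * n ≡ n * n + A * n + (k * k + 1) →
  p * p + q * q ≡ A * n + k * k
semiprime-relation A k p q n eq = +-cancelʳ-≡ 1 _ _ (+-cancelˡ-≡ (n * n) _ _ (begin
  n * n + (p * p + q * q + 1)   ≡⟨ solve (p ∷ q ∷ n ∷ []) ⟩
  1 + p * p + q * q + n * n     ≡⟨ eq ⟩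
  n * n + A * n + (k * k + 1)   ≡⟨ solve (A ∷ k ∷ n ∷ []) ⟩
  n * n + (A * n + k * k + 1)   ∎))
  where open ≡-Reasoning

divisor-relation : ∀ A k m n → 1 + m * m + n * n ≤ n * n + A * n + (k * k + 1) →
  m * m ≤ A * n + k * k
divisor-relation A k m n le = +-cancelʳ-≤ 1 _ _ (+-cancelˡ-≤ (n * n) _ _ (begin
  n * n + (m * m + 1)           ≡⟨ solve (m ∷ n ∷ []) ⟩
  1 + m * m + n * n             ≤⟨ le ⟩
  n * n + A * n + (k * k + 1)   ≡⟨ solve (A ∷ k ∷ n ∷ []) ⟩
  n * n + (A * n + k * k + 1)   ∎))
  where open ≤-Reasoning

-- If n = pm with p² ≤ m and m² ≤ A·n + k², then n < C³ for C = A + k² + 1: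
-- m² < C·pm gives m < Cp, so p² < Cp, p < C and n = pm < p·Cp < C³.
cube-bound : ∀ A k p m → 1 ≤ p → p * p ≤ m → m * m ≤ A * (p * m) + k * k →
  p * m < (A + k * k + 1) * ((A + k * k + 1) * (A + k * k + 1))
cube-bound A k p m 1≤p p²≤m m²≤ = begin-strict
  p * m         <⟨ *-monoʳ-< p {{>-nonZero 1≤p}} m<Cp ⟩
  p * (C * p)   ≡⟨ *-comm p (C * p) ⟩
  C * p * p     ≡⟨ *-assoc C p p ⟩
  C * (p * p)   ≤⟨ *-monoʳ-≤ C (*-mono-≤ (<⇒≤ p<C) (<⇒≤ p<C)) ⟩
  C * (C * C)   ∎
  where
  open ≤-Reasoning
  C = A + k * k + 1
  1≤m : 1 ≤ m
  1≤m = ≤-trans (*-mono-≤ 1≤p 1≤p) p²≤m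
  1≤pm : 1 ≤ p * m
  1≤pm = *-mono-≤ 1≤p 1≤m
  m<Cp : m < C * p
  m<Cp = *-cancelʳ-< m m (C * p) (begin-strict
    m * m                          ≤⟨ m²≤ ⟩
    A * (p * m) + k * k            ≤⟨ +-monoʳ-≤ (A * (p * m)) (m≤m*n (k * k) (p * m) {{>-nonZero 1≤pm}}) ⟩
    A * (p * m) + k * k * (p * m)  <⟨ m<m+n _ {p * m} 1≤pm ⟩
    A * (p * m) + k * k * (p * m) + p * m ≡⟨ collect ⟩
    C * p * m                      ∎)
    where
    collect : A * (p * m) + k * k * (p * m) + p * m ≡ (A + k * k + 1) * p * m
    collect = solve (A ∷ k ∷ p ∷ m ∷ [])
  p<C : p < C
  p<C = *-cancelʳ-< p p C (≤-<-trans p²≤m m<Cp)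

cube : ∀ A k → (A + k ^ 2 + 1) ^ 3 ≡ (A + k * k + 1) * ((A + k * k + 1) * (A + k * k + 1))
cube A k rewrite square k = cong (λ c → C * (C * c)) (*-identityʳ C)
  where C = A + k * k + 1

QuadraticPrimePair : ℕ → ℕ → ℕ → ℕ → Set
QuadraticPrimePair A k p q = Prime p × Prime q × p < q × p * p + q * q ≡ A * (p * q) + k * k

-- Every solution is below C³ = (A + k² + 1)³ or is the product of a quadratic prime pair:
-- primes and prime squares have too few divisors, semiprimes give the quadratic relation,
-- and n = pm with p² ≤ m has the divisor m, which forces n < C³.
solution-structure : ∀ {A k n} → 1 ≤ A → 1 ≤ k → 1 ≤ n → IsSolution A k n →
  n < (A + k ^ 2 + 1) ^ 3 ⊎ ∃₂ λ p q → QuadraticPrimePair A k p q × n ≡ p * q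
solution-structure {A} {k} {n} 1≤A 1≤k 1≤n sol with shape (solution>1 {A} {k} 1≤n sol)
... | prime-shape n-prime =
  contradiction (trans (sym (σ₂-prime n-prime)) (solution-equation {A} {k} {n} sol))
    (divisor-sum-too-small A k n 0 1≤k z≤n)
... | semiprime-shape {p} {q} p-prime q-prime p≤q refl with m≤n⇒m<n∨m≡n p≤q
...   | inj₂ refl =
  contradiction (trans (sym (σ₂-prime-square p-prime)) (solution-equation {A} {k} {p * p} sol))
    (divisor-sum-too-small A k (p * p) (p * p) 1≤k (m≤n*m (p * p) A {{>-nonZero 1≤A}}))
...   | inj₁ p<q = inj₂ (p , q , (p-prime , q-prime , p<q , relation) , refl)
  where
  relation : p * p + q * q ≡ A * (p * q) + k * k
  relation = semiprime-relation A k p q (p * q)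
    (trans (sym (σ₂-semiprime p-prime q-prime p<q)) (solution-equation {A} {k} {p * q} sol))
solution-structure {A} {k} _ _ _ sol | cube-shape {p} {m} 1<p p²≤m refl =
  inj₁ (subst (p * m <_) (sym (cube A k))
    (cube-bound A k p m (<⇒≤ 1<p) p²≤m (divisor-relation A k m (p * m) m-bound)))
  where
  1<m : 1 < m
  1<m = <-≤-trans 1<p (≤-trans (m≤m*n p p {{>-nonZero (<⇒≤ 1<p)}}) p²≤m)
  m<pm : m < p * m
  m<pm = subst (m <_) (*-comm m p) (m<m*n m p {{>-nonZero (<⇒≤ 1<m)}} 1<p)
  m-bound : 1 + m * m + (p * m) * (p * m) ≤ (p * m) * (p * m) + A * (p * m) + (k * k + 1)
  m-bound = subst (1 + m * m + (p * m) * (p * m) ≤_) (solution-equation {A} {k} {p * m} sol)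
    (σ₂-lower-bound 1<m m<pm (n∣m*n p))

sum-of-squares : ∀ p t → p * p + (p + t) * (p + t) ≡ 2 * (p * (p + t)) + t * t
sum-of-squares = solve-∀

square-injective : ∀ {m n} → m * m ≡ n * n → m ≡ n
square-injective {m} {n} m²≡n² with <-cmp m n
... | tri< m<n _ _ = contradiction m²≡n² (<⇒≢ (*-mono-< m<n m<n))
... | tri≈ _ m≡n _ = m≡n
... | tri> _ _ n<m = contradiction m²≡n² (≢-sym (<⇒≢ (*-mono-< n<m n<m)))

∣⇒≡0⊎≥ : ∀ {q c} → q ∣ c → c ≡ 0 ⊎ q ≤ c
∣⇒≡0⊎≥ {c = zero}  _   = inj₁ refl
∣⇒≡0⊎≥ {c = suc _} q∣c = inj₂ (∣⇒≤ q∣c)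

-- Case a ≤ b of prime-congruent-squares: writing b = a + s gives b² = a² + s(a + b),
-- so q ∣ s(a + b) and q divides one of the factors.
congruent-squares-≤ : ∀ {q a b x y} → Prime q → a ≤ b → a * a + q * x ≡ b * b + q * y →
  a ≡ b ⊎ q ≤ a + b
congruent-squares-≤ {q} {a} {x = x} {y} q-prime a≤b eq with m≤n⇒∃[o]m+o≡n a≤b
... | s , refl = from-factor (euclidsLemma s (a + (a + s)) q-prime q∣s[a+b])
  where
  q∣s[a+b] : q ∣ s * (a + (a + s))
  q∣s[a+b] = ∣m+n∣m⇒∣n (subst (q ∣_) (+-cancelˡ-≡ (a * a) _ _ (begin
    a * a + q * x                        ≡⟨ eq ⟩
    (a + s) * (a + s) + q * y            ≡⟨ solve (a ∷ s ∷ q ∷ y ∷ []) ⟩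
    a * a + (q * y + s * (a + (a + s)))  ∎)) (m∣m*n x)) (m∣m*n y)
    where open ≡-Reasoning
  from-factor : q ∣ s ⊎ q ∣ a + (a + s) → a ≡ a + s ⊎ q ≤ a + (a + s)
  from-factor (inj₁ q∣s) with ∣⇒≡0⊎≥ q∣s
  ... | inj₁ s≡0 = inj₁ (sym (trans (cong (a +_) s≡0) (+-identityʳ a)))
  ... | inj₂ q≤s = inj₂ (≤-trans q≤s (≤-trans (m≤n+m s a) (m≤n+m (a + s) a)))
  from-factor (inj₂ q∣a+b) with ∣⇒≡0⊎≥ q∣a+b
  ... | inj₁ a+b≡0 = inj₁ (trans (m+n≡0⇒m≡0 a a+b≡0) (sym (m+n≡0⇒n≡0 a a+b≡0)))
  ... | inj₂ q≤a+b = inj₂ q≤a+b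

-- If a² ≡ b² modulo a prime q, then q divides a − b or a + b; hence a = b or q ≤ a + b.
prime-congruent-squares : ∀ {q a b x y} → Prime q → a * a + q * x ≡ b * b + q * y →
  a ≡ b ⊎ q ≤ a + b
prime-congruent-squares {q} {a} {b} q-prime eq with ≤-total a b
... | inj₁ a≤b = congruent-squares-≤ q-prime a≤b eq
... | inj₂ b≤a with congruent-squares-≤ q-prime b≤a (sym eq)
...   | inj₁ b≡a   = inj₁ (sym b≡a)
...   | inj₂ q≤b+a = inj₂ (subst (q ≤_) (+-comm b a) q≤b+a)

-- A = 1: as p² + q² ≥ 2pq, the relation p² + q² = pq + k² forces pq ≤ k².
pair-bound-A≡1 : ∀ {k p q} → p ≤ q → p * p + q * q ≡ 1 * (p * q) + k * k → p * q ≤ k * k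
pair-bound-A≡1 {k} {p} p≤q rel with m≤n⇒∃[o]m+o≡n p≤q
... | t , refl = ≤-trans (m≤m+n (p * (p + t)) (t * t)) (≤-reflexive (+-cancelˡ-≡ (p * (p + t)) _ _ (begin
  p * (p + t) + (p * (p + t) + t * t)  ≡⟨ solve (p ∷ t ∷ []) ⟩
  2 * (p * (p + t)) + t * t            ≡⟨ sym (sum-of-squares p t) ⟩
  p * p + (p + t) * (p + t)            ≡⟨ rel ⟩
  1 * (p * (p + t)) + k * k            ≡⟨ cong (_+ k * k) (*-identityˡ (p * (p + t))) ⟩
  p * (p + t) + k * k                  ∎)))
  where open ≡-Reasoning

-- A = 2: the relation says (q − p)² = k², so q = p + k.
twin-cofactor : ∀ {k p q} → p ≤ q → p * p + q * q ≡ 2 * (p * q) + k * k → q ≡ p + k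
twin-cofactor {k} {p} p≤q rel with m≤n⇒∃[o]m+o≡n p≤q
... | t , refl = cong (p +_) (square-injective (+-cancelˡ-≡ (2 * (p * (p + t))) _ _
  (trans (sym (sum-of-squares p t)) rel)))

-- A ≥ 3: a cofactor q ≤ p + k is too close to p, since then
-- p² + q² = 2pq + (q − p)² < 3pq + k².
close-cofactor-impossible : ∀ {A k p q} → 3 ≤ A → 1 ≤ p → p ≤ q → q ≤ p + k →
  p * p + q * q ≢ A * (p * q) + k * k
close-cofactor-impossible {A} {k} {p} 3≤A 1≤p p≤q q≤p+k with m≤n⇒∃[o]m+o≡n p≤q
... | t , refl = <⇒≢ (begin-strict
  p * p + (p + t) * (p + t)  ≡⟨ sum-of-squares p t ⟩
  2 * (p * (p + t)) + t * t  <⟨ +-monoˡ-< (t * t) (*-monoˡ-< (p * (p + t)) {{>-nonZero pq≥1}} (n<1+n 2)) ⟩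
  3 * (p * (p + t)) + t * t  ≤⟨ +-mono-≤ (*-monoˡ-≤ (p * (p + t)) 3≤A) (*-mono-≤ t≤k t≤k) ⟩
  A * (p * (p + t)) + k * k  ∎)
  where
  open ≤-Reasoning
  t≤k : t ≤ k
  t≤k = +-cancelˡ-≤ p t k q≤p+k
  pq≥1 : 1 ≤ p * (p + t)
  pq≥1 = *-mono-≤ 1≤p (≤-trans 1≤p (m≤m+n p t))

-- A ≥ 3: since p² ≡ k² (mod q), the prime q divides p − k or p + k; the second option is
-- too close, so p = k, and then q² = A·pq gives q = Ak and pq = Ak².
pair-A≥3 : ∀ {A k p q} → 3 ≤ A → QuadraticPrimePair A k p q → p * q ≡ A * (k * k)
pair-A≥3 {A} {k} {p} {q} 3≤A (p-prime , q-prime , p<q , rel)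
  with prime-congruent-squares {a = p} {b = k} {x = q} {y = A * p} q-prime (trans rel regroup)
  where
  regroup : A * (p * q) + k * k ≡ k * k + q * (A * p)
  regroup = solve (A ∷ p ∷ q ∷ k ∷ [])
... | inj₂ q≤p+k =
  contradiction rel (close-cofactor-impossible 3≤A (<⇒≤ (prime⇒1<p p-prime)) (<⇒≤ p<q) q≤p+k)
... | inj₁ refl = begin
  p * q         ≡⟨ cong (p *_) q≡Ap ⟩
  p * (A * p)   ≡⟨ solve (A ∷ p ∷ []) ⟩
  A * (p * p)   ∎
  where
  open ≡-Reasoning
  q≡Ap : q ≡ A * p
  q≡Ap = *-cancelʳ-≡ q (A * p) q {{prime⇒nonZero q-prime}} (+-cancelʳ-≡ (p * p) _ _ (begin
    q * q + p * p        ≡⟨ +-comm (q * q) (p * p) ⟩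
    p * p + q * q        ≡⟨ rel ⟩
    A * (p * q) + p * p  ≡⟨ cong (_+ p * p) (sym (*-assoc A p q)) ⟩
    A * p * q + p * p    ∎))

even-or-odd : ∀ a → 2 ∣ a ⊎ 2 ∣ suc a
even-or-odd zero = inj₁ (divides 0 refl)
even-or-odd (suc a) with even-or-odd a
... | inj₁ 2∣a   = inj₂ (∣m∣n⇒∣m+n ∣-refl 2∣a)
... | inj₂ 2∣1+a = inj₁ 2∣1+a

odd+odd-even : ∀ {a b} → ¬ 2 ∣ a → ¬ 2 ∣ b → 2 ∣ a + b
odd+odd-even {a} {b} a-odd b-odd with even-or-odd a | even-or-odd b
... | inj₁ 2∣a | _ = contradiction 2∣a a-odd
... | _ | inj₁ 2∣b = contradiction 2∣b b-odd
... | inj₂ 2∣1+a | inj₂ 2∣1+b =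
  ∣m+n∣m⇒∣n (subst (2 ∣_) (cong suc (+-suc a b)) (∣m∣n⇒∣m+n 2∣1+a 2∣1+b)) ∣-refl

even-prime : ∀ {p} → Prime p → 2 ∣ p → p ≡ 2
even-prime p-prime 2∣p with prime⇒irreducible p-prime 2∣p
... | inj₂ 2≡p = sym 2≡p

-- If p and p + k are both prime and k is odd, one of them is even, and it must be p = 2.
odd-gap-prime-pair : ∀ {p k} → Prime p → Prime (p + k) → ¬ 2 ∣ k → p ≡ 2
odd-gap-prime-pair {p} p-prime _ k-odd with 2 ∣? p
... | yes 2∣p = even-prime p-prime 2∣p
odd-gap-prime-pair {p} {zero} _ _ k-odd | no _ = contradiction (divides 0 refl) k-odd
odd-gap-prime-pair {p} {suc k} p-prime p+k-prime k-odd | no p-odd =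
  contradiction (even-prime p+k-prime (odd+odd-even p-odd k-odd))
    (>⇒≢ (+-mono-≤ (prime⇒1<p p-prime) (s≤s z≤n)))

-- Away from the twin case A = 2, k even, quadratic prime pairs are bounded:
-- pq ≤ k² for A = 1, pq = Ak² for A ≥ 3, and pq = 2(2 + k) for A = 2 with k odd.
pair-bound : ∀ {A k p q} → 1 ≤ A → (¬ A ≡ 2 ⊎ ¬ 2 ∣ k) → QuadraticPrimePair A k p q →
  p * q ≤ A * (k * k) ⊔ 2 * (2 + k)
pair-bound {1} {k} {p} {q} _ _ (_ , _ , p<q , rel) =
  m≤n⇒m≤n⊔o _ (subst (p * q ≤_) (sym (*-identityˡ (k * k))) (pair-bound-A≡1 {k} {p} {q} (<⇒≤ p<q) rel))
pair-bound {2} _ (inj₁ A≢2) _ = contradiction refl A≢2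
pair-bound {2} {k} {p} {q} _ (inj₂ k-odd) (p-prime , q-prime , p<q , rel) =
  m≤n⇒m≤o⊔n _ (≤-reflexive (begin
    p * q        ≡⟨ cong (p *_) q≡p+k ⟩
    p * (p + k)  ≡⟨ cong (λ r → r * (r + k)) p≡2 ⟩
    2 * (2 + k)  ∎))
  where
  open ≡-Reasoning
  q≡p+k : q ≡ p + k
  q≡p+k = twin-cofactor (<⇒≤ p<q) rel
  p≡2 : p ≡ 2
  p≡2 = odd-gap-prime-pair p-prime (subst Prime q≡p+k q-prime) k-odd
pair-bound {A@(suc (suc (suc _)))} {k} {p} {q} _ _ pair =
  m≤n⇒m≤n⊔o _ (≤-reflexive (pair-A≥3 {A} {k} {p} {q} (s≤s (s≤s (s≤s z≤n))) pair))

solutions-bounded : ∀ {A k n} → 1 ≤ A → 1 ≤ k → (¬ A ≡ 2 ⊎ ¬ 2 ∣ k) → 1 ≤ n →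
  IsSolution A k n → n ≤ (A + k ^ 2 + 1) ^ 3 ⊔ (A * (k * k) ⊔ 2 * (2 + k))
solutions-bounded {A} {k} 1≤A 1≤k not-twin 1≤n sol with solution-structure {A} {k} 1≤A 1≤k 1≤n sol
... | inj₁ n<C³                  = m≤n⇒m≤n⊔o _ (<⇒≤ n<C³)
... | inj₂ (p , q , pair , refl) =
  m≤n⇒m≤o⊔n ((A + k ^ 2 + 1) ^ 3) (pair-bound {A} {k} {p} {q} 1≤A not-twin pair)

large-solutions-A≡2 : ∀ {k n} → 1 ≤ k → 1 ≤ n → IsSolution 2 k n → n ≥ (2 + k ^ 2 + 1) ^ 3 →
  ∃ λ p → Prime p × Prime (p + k) × n ≡ p * (p + k)
large-solutions-A≡2 {k} 1≤k 1≤n sol n≥C³ with solution-structure {2} {k} (s≤s z≤n) 1≤k 1≤n sol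
... | inj₁ n<C³ = contradiction n≥C³ (<⇒≱ n<C³)
... | inj₂ (p , q , (p-prime , q-prime , p<q , rel) , refl) =
  p , p-prime , subst Prime q≡p+k q-prime , cong (p *_) q≡p+k
  where
  q≡p+k : q ≡ p + k
  q≡p+k = twin-cofactor (<⇒≤ p<q) rel

theorem1p6 :
    (A k : ℕ) → NonZero A → NonZero k →
      (((¬ (A ≡ 2)) ⊎ (¬ (2 ∣ k))) →
        ∃ λ B → ∀ n → NonZero n → IsSolution A k n → n ≤ B)
      × ((A ≡ 2) → 2 ∣ k →
        ∀ n → NonZero n → IsSolution A k n → n ≥ (A + k ^ 2 + 1) ^ 3 →
          ∃ λ p → Prime p × Prime (p + k) × (n ≡ p * (p + k)))
theorem1p6 A k nzA nzk = part-i , part-ii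
  where
  1≤A : 1 ≤ A
  1≤A = >-nonZero⁻¹ A {{nzA}}
  1≤k : 1 ≤ k
  1≤k = >-nonZero⁻¹ k {{nzk}}
  part-i : ¬ A ≡ 2 ⊎ ¬ 2 ∣ k → ∃ λ B → ∀ n → NonZero n → IsSolution A k n → n ≤ B
  part-i not-twin =
    _ , λ n nzn sol → solutions-bounded {A} {k} 1≤A 1≤k not-twin (>-nonZero⁻¹ n {{nzn}}) sol
  -- part (ii) holds without using that k is even
  part-ii : A ≡ 2 → 2 ∣ k → ∀ n → NonZero n → IsSolution A k n → n ≥ (A + k ^ 2 + 1) ^ 3 →
    ∃ λ p → Prime p × Prime (p + k) × n ≡ p * (p + k)
  part-ii refl _ n nzn sol = large-solutions-A≡2 {k} 1≤k (>-nonZero⁻¹ n {{nzn}}) sol
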